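{- Let $p\equiv 1\pmod 6$ be a prime and $a\in\mathbb{F}_p^*$. Let $N_{p,a}$ be the number of $\mathbb{F}_p$-rational points (including the point at infinity) of $y^{2}=x^{3}+a^{3}$ over $\mathbb{F}_p$, and $b=p+1-N_{p,a}$. If $N_{p,a}\equiv 0\pmod 6$, then $b\equiv 2\pmod 6$. -}

module Defs where

open import Data.Nat using (ℕ; zero; suc; _+_; _*_; _^_; _%_; NonZero)
open import Data.Nat.Properties using (_≟_)
open import Data.Fin using (Fin; toℕ)
open import Data.List using (List; length; filter; allFin; cartesianProduct)
open import Data.Product using (_×_; _,_)
open import Relation.Binary.PropositionalEquality using (_≡_)
open import Relation.Nullary using (Dec)

-- F_p is modelled as Fin p, with element x ∈ Fin p identified with the
-- residue toℕ x mod p.  Arithmetic is done in ℕ and reduced mod p.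

OnCurve : (p : ℕ) .{{_ : NonZero p}} → ℕ → Fin p × Fin p → Set
OnCurve p c (x , y) = (toℕ y ^ 2) % p ≡ (toℕ x ^ 3 + c) % p

onCurve? : (p : ℕ) .{{_ : NonZero p}} → (c : ℕ) → (q : Fin p × Fin p) →
           Dec (OnCurve p c q)
onCurve? p c (x , y) = ((toℕ y ^ 2) % p) ≟ ((toℕ x ^ 3 + c) % p)

-- Number of F_p-rational points of y^2 = x^3 + c, including the point at infinity.
numPoints : (p : ℕ) .{{_ : NonZero p}} → ℕ → ℕ
numPoints p c = suc (length (filter (onCurve? p c) (cartesianProduct (allFin p) (allFin p))))

{-# OPTIONS --safe #-}
-- Since b = (p + 1) - N with p + 1 ≡ 2 and N ≡ 0 (mod 6), b ≡ 2 (mod 6).  The only work is that the integer remainder _%ℕ_ is invariant under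
-- adding multiples of the modulus, which is checked on the negative branch of its definition.
module Submission where

open import Defs
open import Data.Nat as ℕ using (ℕ; _^_; _%_; _+_; _*_; _∸_; _≤_; NonZero; zero; suc; s≤s)
import Data.Nat.Properties as ℕ
open import Data.Nat.DivMod
  using (m<n⇒m%n≡m; n%n≡0; [m+n]%n≡m%n; m≤n⇒[n∸m]%m≡n%m; %-distribˡ-+)
open import Data.Nat.Divisibility using (_∣_; divides; m%n≡0⇒n∣m)
open import Data.Nat.Primality using (Prime)
open import Data.Integer as ℤ using (ℤ; +_; -[1+_]; _-_; _⊖_)
import Data.Integer.Properties as ℤ
open import Data.Integer.DivMod using (_%ℕ_)
open import Data.Fin using (Fin; toℕ)
open import Data.Sum using (inj₁; inj₂)
open import Relation.Nullary using (yes; no)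
open import Relation.Binary.PropositionalEquality

-[1+n]%ℕd≡[d∸[1+n]%d]%d : ∀ n d .{{_ : NonZero d}} →
                          -[1+ n ] %ℕ d ≡ (d ∸ suc n % d) % d
-[1+n]%ℕd≡[d∸[1+n]%d]%d n d@(suc d-1) with suc n % d
... | zero  = sym (n%n≡0 d)
... | suc r = sym (m<n⇒m%n≡m (s≤s (ℕ.m∸n≤m d-1 r)))

[d∸m]%d≡[d∸m%d]%d : ∀ {m} d .{{_ : NonZero d}} → m ≤ d → (d ∸ m) % d ≡ (d ∸ m % d) % d
[d∸m]%d≡[d∸m%d]%d d@(suc _) m≤d with ℕ.m≤n⇒m<n∨m≡n m≤d
... | inj₁ m<d  = cong (λ k → (d ∸ k) % d) (sym (m<n⇒m%n≡m m<d))
... | inj₂ refl = begin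
  (d ∸ d) % d       ≡⟨ cong (_% d) (ℕ.n∸n≡0 d) ⟩
  0                 ≡⟨ sym (n%n≡0 d) ⟩
  d % d             ≡⟨ cong (λ k → (d ∸ k) % d) (sym (n%n≡0 d)) ⟩
  (d ∸ d % d) % d   ∎
  where open ≡-Reasoning

[d+i]%ℕd≡i%ℕd : ∀ i d .{{_ : NonZero d}} → (+ d ℤ.+ i) %ℕ d ≡ i %ℕ d
[d+i]%ℕd≡i%ℕd (+ n)    d = trans (cong (_% d) (ℕ.+-comm d n)) ([m+n]%n≡m%n n d)
[d+i]%ℕd≡i%ℕd -[1+ n ] d with suc n ℕ.≤? d
... | yes 1+n≤d = begin
  (d ⊖ suc n) %ℕ d          ≡⟨ cong (_%ℕ d) (ℤ.⊖-≥ 1+n≤d) ⟩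
  (d ∸ suc n) % d           ≡⟨ [d∸m]%d≡[d∸m%d]%d d 1+n≤d ⟩
  (d ∸ suc n % d) % d       ≡⟨ sym (-[1+n]%ℕd≡[d∸[1+n]%d]%d n d) ⟩
  -[1+ n ] %ℕ d             ∎
  where open ≡-Reasoning
... | no 1+n≰d = begin
  (d ⊖ suc n) %ℕ d          ≡⟨ cong (_%ℕ d) (ℤ.⊖-< d<1+n) ⟩
  (ℤ.- + (suc n ∸ d)) %ℕ d  ≡⟨ cong (λ k → (ℤ.- + k) %ℕ d) (ℕ.+-∸-assoc 1 d≤n) ⟩
  -[1+ n ∸ d ] %ℕ d         ≡⟨ -[1+n]%ℕd≡[d∸[1+n]%d]%d (n ∸ d) d ⟩
  (d ∸ suc (n ∸ d) % d) % d ≡⟨ cong (λ k → (d ∸ k % d) % d) (sym (ℕ.+-∸-assoc 1 d≤n)) ⟩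
  (d ∸ (suc n ∸ d) % d) % d ≡⟨ cong (λ k → (d ∸ k) % d) (m≤n⇒[n∸m]%m≡n%m (ℕ.<⇒≤ d<1+n)) ⟩
  (d ∸ suc n % d) % d       ≡⟨ sym (-[1+n]%ℕd≡[d∸[1+n]%d]%d n d) ⟩
  -[1+ n ] %ℕ d             ∎
  where
  open ≡-Reasoning
  d<1+n = ℕ.≰⇒> 1+n≰d
  d≤n   = ℕ.≤-pred d<1+n

[kd+i]%ℕd≡i%ℕd : ∀ k i d .{{_ : NonZero d}} → (+ (k * d) ℤ.+ i) %ℕ d ≡ i %ℕ d
[kd+i]%ℕd≡i%ℕd zero    i d = cong (_%ℕ d) (ℤ.+-identityˡ i)
[kd+i]%ℕd≡i%ℕd (suc k) i d = begin
  (+ (d + k * d) ℤ.+ i) %ℕ d       ≡⟨ cong (λ j → (j ℤ.+ i) %ℕ d) (ℤ.pos-+ d (k * d)) ⟩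
  (+ d ℤ.+ + (k * d) ℤ.+ i) %ℕ d   ≡⟨ cong (_%ℕ d) (ℤ.+-assoc (+ d) (+ (k * d)) i) ⟩
  (+ d ℤ.+ (+ (k * d) ℤ.+ i)) %ℕ d ≡⟨ [d+i]%ℕd≡i%ℕd (+ (k * d) ℤ.+ i) d ⟩
  (+ (k * d) ℤ.+ i) %ℕ d           ≡⟨ [kd+i]%ℕd≡i%ℕd k i d ⟩
  i %ℕ d                           ∎
  where open ≡-Reasoning

i+[j-i]≡j : ∀ (i j : ℤ) → i ℤ.+ (j - i) ≡ j
i+[j-i]≡j i j = begin
  i ℤ.+ (j - i)        ≡⟨ ℤ.+-comm i (j - i) ⟩
  j - i ℤ.+ i          ≡⟨ ℤ.+-assoc j (ℤ.- i) i ⟩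
  j ℤ.+ (ℤ.- i ℤ.+ i)  ≡⟨ cong (λ k → j ℤ.+ k) (ℤ.+-inverseˡ i) ⟩
  j ℤ.+ ℤ.0ℤ           ≡⟨ ℤ.+-identityʳ j ⟩
  j                    ∎
  where open ≡-Reasoning

d∣n⇒[m-n]%ℕd≡m%d : ∀ m {n} d .{{_ : NonZero d}} → d ∣ n → (+ m - + n) %ℕ d ≡ m % d
d∣n⇒[m-n]%ℕd≡m%d m d (divides k refl) = begin
  (+ m - + (k * d)) %ℕ d                 ≡⟨ sym ([kd+i]%ℕd≡i%ℕd k (+ m - + (k * d)) d) ⟩
  (+ (k * d) ℤ.+ (+ m - + (k * d))) %ℕ d ≡⟨ cong (_%ℕ d) (i+[j-i]≡j (+ (k * d)) (+ m)) ⟩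
  m % d                                  ∎
  where open ≡-Reasoning

corollary14 : (p : ℕ) .{{_ : NonZero p}} → Prime p → p % 6 ≡ 1 →
    (a : Fin p) → toℕ a ≢ 0 →
    numPoints p (toℕ a ^ 3) % 6 ≡ 0 →
    ((+ (p + 1)) - (+ numPoints p (toℕ a ^ 3))) %ℕ 6 ≡ 2
corollary14 p _ p%6≡1 a _ N%6≡0 = begin
  (+ (p + 1) - + N) %ℕ 6   ≡⟨ d∣n⇒[m-n]%ℕd≡m%d (p + 1) 6 (m%n≡0⇒n∣m N 6 N%6≡0) ⟩
  (p + 1) % 6              ≡⟨ %-distribˡ-+ p 1 6 ⟩
  (p % 6 + 1) % 6          ≡⟨ cong (λ r → (r + 1) % 6) p%6≡1 ⟩
  2                        ∎
  where
  open ≡-Reasoning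
  N = numPoints p (toℕ a ^ 3)
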